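{- Let $H$ be a connected graph of order $m\ge2$ and $n\ge2$. Then $Z(K_n\circ H)=Z(H)+(n-1)m$.
   Context: $K_n$ is the complete graph on $n$ vertices. Zero forcing: given a set $S$ of initially black vertices (others white), the color-change rule turns a white vertex black if it is the only white neighbor of some black vertex; $S$ is a zero forcing set if eventually all vertices become black; $Z(G)$ is the minimum size of a zero forcing set. The lexicographic product $G\circ H$ has vertex set $V(G)\times V(H)$, with $(a,v)$ adjacent to $(b,w)$ iff $ab\in E(G)$, or $a=b$ and $vw\in E(H)$. -}

module Defs where

open import Data.Nat using (ℕ; _≤_)
open import Data.Bool using (Bool; true; false; _∨_; _∧_)
open import Data.Fin using (Fin; combine; remQuot)
open import Data.Fin.Properties using (_≟_)
open import Data.Fin.Subset using (Subset; _∈_; ∣_∣)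
open import Data.Product using (Σ; _×_; _,_)
open import Relation.Binary.PropositionalEquality using (_≡_; _≢_)
open import Relation.Nullary.Decidable using (⌊_⌋)
open import Relation.Binary.Construct.Closure.ReflexiveTransitive using (Star)

Graph : ℕ → Set
Graph n = Fin n → Fin n → Bool

Adj : ∀ {n} → Graph n → Fin n → Fin n → Set
Adj G u v = G u v ≡ true

IsSimple : ∀ {n} → Graph n → Set
IsSimple G = (∀ u v → G u v ≡ G v u) × (∀ u → G u u ≡ false)

Connected : ∀ {n} → Graph n → Set
Connected G = ∀ u v → Star (Adj G) u v

K : (n : ℕ) → Graph n
K n a b = Data.Bool.not ⌊ a ≟ b ⌋

-- lexicographic product G ∘ H; vertex (a , v) is encoded as combine a v : Fin (n * m)
lex : ∀ {n m} → Graph n → Graph m → Graph (n Data.Nat.* m)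
lex {n} {m} G H i j with remQuot m i | remQuot m j
... | (a , v) | (b , w) = G a b ∨ (⌊ a ≟ b ⌋ ∧ H v w)

-- Vertices eventually black when starting from S and applying the
-- colour-change rule: a black vertex u with exactly one white neighbour v
-- forces v.  (Least set containing S closed under forcing.)
data Black {n} (G : Graph n) (S : Subset n) : Fin n → Set where
  init  : ∀ {v} → v ∈ S → Black G S v
  force : ∀ {u v} → Black G S u → Adj G u v →
          (∀ w → Adj G u w → w ≢ v → Black G S w) → Black G S v

IsZeroForcingSet : ∀ {n} → Graph n → Subset n → Set
IsZeroForcingSet G S = ∀ v → Black G S v

IsZ : ∀ {n} → Graph n → ℕ → Set
IsZ {n} G k =
  (Σ (Subset n) λ S → IsZeroForcingSet G S × ∣ S ∣ ≡ k) ×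
  (∀ S → IsZeroForcingSet G S → k ≤ ∣ S ∣)

-- Upper bound: a zero forcing set T of H placed in the first copy, together with all other
-- copies, is zero forcing in K_n ∘ H: a vertex sees every copy other than its own completely,
-- so the forces of H inside the first copy remain forces.
-- Lower bound: from a zero forcing set S, either S is everything or its first force
-- (d,x) → t exists; adding t gives R with ∣R∣ ≤ ∣S∣ + 1 containing (d,x) and all its
-- neighbours, hence every copy except the d-th. The slice T of R in copy d is zero forcing
-- in H: a force into copy d from outside leaves only its target white in that copy, and any
-- H-neighbour of the target then forces it. As T contains x and its neighbours, T minus a
-- neighbour w of x is still zero forcing (x forces w), so
-- Z(H) + 1 + (n-1)m ≤ ∣T∣ + (n-1)m = ∣R∣ ≤ ∣S∣ + 1.
module Submission where

open import Defs
open import Data.Nat using (ℕ; suc; _≤_; _+_; _*_; _∸_; z≤n; s≤s)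
open import Data.Nat.Properties
  using ( module ≤-Reasoning; ≤-trans; ≤-antisym; ≤-reflexive; ≤-pred; n≤1+n
        ; +-suc; +-comm; +-assoc; +-monoˡ-≤; +-monoʳ-≤)
open import Data.Bool using (Bool; true; false; _∨_; _∧_)
open import Data.Bool.Properties using () renaming (_≟_ to _≟ᵇ_)
open import Data.Fin using (Fin; zero; suc; combine; punchIn)
open import Data.Fin.Properties
  using (_≟_; suc-injective; any?; punchInᵢ≢i; remQuot-combine; combine-surjective; combine-injectiveʳ)
open import Data.Fin.Subset using (Subset; inside; outside; _∈_; _∉_; _⊆_; ∣_∣; ⊤; ⁅_⁆; _∪_; _-_)
open import Data.Fin.Subset.Properties
  using ( _∈?_; ∈⊤; x∈⁅x⁆; ∣p∣≤n; ∣p∣≤∣x∷p∣; ∣⊤∣≡n; ∣⁅x⁆∣≡1; p⊆q⇒∣p∣≤∣q∣; p⊆p∪q; q⊆p∪q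
        ; x∈p∧x≢y⇒x∈p-y; x∈p⇒∣p-x∣<∣p∣)
open import Data.Vec using (Vec; []; _∷_; _++_; concat; group; lookup; map; sum)
open import Data.Vec.Properties
  using (lookup-concat; lookup-map; lookup-++ˡ; lookup-++ʳ; []=⇒lookup; lookup⇒[]=)
open import Data.Product using (∃; ∃₂; _×_; _,_; proj₁; proj₂)
open import Function using (id; _∘_)
open import Relation.Binary.PropositionalEquality
  using (_≡_; _≢_; refl; sym; trans; cong; cong₂; subst; module ≡-Reasoning)
open import Relation.Nullary using (yes; no; ¬?; _×-dec_; contradiction)
open import Relation.Nullary.Decidable using (⌊_⌋; decidable-stable)
open import Relation.Binary.Construct.Closure.ReflexiveTransitive using (Star; ε; _◅_)

∣p∪q∣≤∣p∣+∣q∣ : ∀ {n} (p q : Subset n) → ∣ p ∪ q ∣ ≤ ∣ p ∣ + ∣ q ∣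
∣p∪q∣≤∣p∣+∣q∣ []            []            = z≤n
∣p∪q∣≤∣p∣+∣q∣ (inside  ∷ p) (b       ∷ q) =
  s≤s (≤-trans (∣p∪q∣≤∣p∣+∣q∣ p q) (+-monoʳ-≤ ∣ p ∣ (∣p∣≤∣x∷p∣ b q)))
∣p∪q∣≤∣p∣+∣q∣ (outside ∷ p) (inside  ∷ q) =
  ≤-trans (s≤s (∣p∪q∣≤∣p∣+∣q∣ p q)) (≤-reflexive (sym (+-suc ∣ p ∣ ∣ q ∣)))
∣p∪q∣≤∣p∣+∣q∣ (outside ∷ p) (outside ∷ q) = ∣p∪q∣≤∣p∣+∣q∣ p q

∣p++q∣≡∣p∣+∣q∣ : ∀ {m n} (p : Subset m) (q : Subset n) → ∣ p ++ q ∣ ≡ ∣ p ∣ + ∣ q ∣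
∣p++q∣≡∣p∣+∣q∣ []            q = refl
∣p++q∣≡∣p∣+∣q∣ (inside  ∷ p) q = cong suc (∣p++q∣≡∣p∣+∣q∣ p q)
∣p++q∣≡∣p∣+∣q∣ (outside ∷ p) q = ∣p++q∣≡∣p∣+∣q∣ p q

∣concat∣≡sum : ∀ {m n} (ps : Vec (Subset m) n) → ∣ concat ps ∣ ≡ sum (map ∣_∣ ps)
∣concat∣≡sum []       = refl
∣concat∣≡sum (p ∷ ps) = trans (∣p++q∣≡∣p∣+∣q∣ p (concat ps)) (cong (∣ p ∣ +_) (∣concat∣≡sum ps))

sum-const : ∀ {n} (xs : Vec ℕ n) {k} → (∀ i → lookup xs i ≡ k) → sum xs ≡ n * k
sum-const []       _      = refl
sum-const (x ∷ xs) xs≡k = cong₂ _+_ (xs≡k zero) (sum-const xs (xs≡k ∘ suc))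

sum-all-but-one : ∀ {n} (xs : Vec ℕ n) a {k} → (∀ i → i ≢ a → lookup xs i ≡ k) →
                  sum xs ≡ lookup xs a + (n ∸ 1) * k
sum-all-but-one               (x ∷ xs) zero        xs≡k = cong (x +_) (sum-const xs (λ i → xs≡k (suc i) λ ()))
sum-all-but-one {suc (suc n)} (x ∷ xs) (suc a) {k} xs≡k = begin
  x + sum xs                        ≡⟨ cong₂ _+_ (xs≡k zero λ ()) (sum-all-but-one xs a xs≡k′) ⟩
  k + (lookup xs a + n * k)         ≡⟨ sym (+-assoc k _ _) ⟩
  k + lookup xs a + n * k           ≡⟨ cong (_+ n * k) (+-comm k (lookup xs a)) ⟩
  lookup xs a + k + n * k           ≡⟨ +-assoc (lookup xs a) k _ ⟩
  lookup xs a + (k + n * k)         ∎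
  where
    open ≡-Reasoning
    xs≡k′ : ∀ i → i ≢ a → lookup xs i ≡ k
    xs≡k′ i i≢a = xs≡k (suc i) (i≢a ∘ suc-injective)

module _ {k : ℕ} {G : Graph k} where

  Black-trans : ∀ {S R : Subset k} → (∀ {v} → v ∈ R → Black G S v) →
                ∀ {v} → Black G R v → Black G S v
  Black-trans R⊆Black (init v∈R)        = R⊆Black v∈R
  Black-trans R⊆Black (force bu uv rest) =
    force (Black-trans R⊆Black bu) uv (λ w uw w≢v → Black-trans R⊆Black (rest w uw w≢v))

  Black-mono : ∀ {S R : Subset k} → S ⊆ R → ∀ {v} → Black G S v → Black G R v
  Black-mono S⊆R = Black-trans (init ∘ S⊆R)

  record Forces (S : Subset k) (u v : Fin k) : Set where
    field
      source∈ : u ∈ S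
      target∉ : v ∉ S
      adjacent : Adj G u v
      others∈ : ∀ w → Adj G u w → w ≢ v → w ∈ S

  first-force : ∀ {S v} → Black G S v → v ∉ S → ∃₂ (Forces S)
  first-force (init v∈S) v∉S = contradiction v∈S v∉S
  first-force {S} (force {u} {v} bu uv rest) v∉S with u ∈? S
  ... | no u∉S = first-force bu u∉S
  ... | yes u∈S with any? (λ w → (G u w ≟ᵇ true) ×-dec ¬? (w ≟ v) ×-dec ¬? (w ∈? S))
  ...   | yes (w , uw , w≢v , w∉S) = first-force (rest w uw w≢v) w∉S
  ...   | no none = u , v , record
    { source∈ = u∈S ; target∉ = v∉S ; adjacent = uv
    ; others∈ = λ w uw w≢v → decidable-stable (w ∈? S) (λ w∉S → none (w , uw , w≢v , w∉S)) }

  record ClosedNeighbourhoodExtension (S : Subset k) : Set where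
    field
      R : Subset k
      centre : Fin k
      S⊆R : S ⊆ R
      ∣R∣≤1+∣S∣ : ∣ R ∣ ≤ suc ∣ S ∣
      centre∈R : centre ∈ R
      neighbours∈R : ∀ w → Adj G centre w → w ∈ R

  extend-to-closed-neighbourhood : ∀ {S} → IsZeroForcingSet G S → Fin k → ClosedNeighbourhoodExtension S
  extend-to-closed-neighbourhood {S} S-zfs v₀ with any? (λ v → ¬? (v ∈? S))
  ... | no none = record
    { R = S ; centre = v₀ ; S⊆R = id ; ∣R∣≤1+∣S∣ = n≤1+n ∣ S ∣
    ; centre∈R = ∈S v₀ ; neighbours∈R = λ w _ → ∈S w }
    where
      ∈S : ∀ v → v ∈ S
      ∈S v = decidable-stable (v ∈? S) (λ v∉S → none (v , v∉S))
  ... | yes (v , v∉S) with first-force (S-zfs v) v∉S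
  ...   | u , t , u→t = record
    { R = S ∪ ⁅ t ⁆ ; centre = u ; S⊆R = p⊆p∪q ⁅ t ⁆
    ; ∣R∣≤1+∣S∣ = ≤-trans (∣p∪q∣≤∣p∣+∣q∣ S ⁅ t ⁆)
                          (≤-reflexive (trans (cong (∣ S ∣ +_) (∣⁅x⁆∣≡1 t)) (+-comm ∣ S ∣ 1)))
    ; centre∈R = p⊆p∪q ⁅ t ⁆ source∈ ; neighbours∈R = neighbours∈ }
    where
      open Forces u→t
      neighbours∈ : ∀ w → Adj G u w → w ∈ S ∪ ⁅ t ⁆
      neighbours∈ w uw with w ≟ t
      ... | yes refl = q⊆p∪q S ⁅ t ⁆ (x∈⁅x⁆ t)
      ... | no w≢t = p⊆p∪q ⁅ t ⁆ (others∈ w uw w≢t)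

  forced-vertex-removable : ∀ {S u w} → IsZeroForcingSet G S → u ∈ S → Adj G u w → u ≢ w →
                            (∀ y → Adj G u y → y ∈ S) → IsZeroForcingSet G (S - w)
  forced-vertex-removable {S} {u} {w} S-zfs u∈S uw u≢w neighbours∈S v = Black-trans S⊆Black (S-zfs v)
    where
      S⊆Black : ∀ {y} → y ∈ S → Black G (S - w) y
      S⊆Black {y} y∈S with y ≟ w
      ... | yes refl = force (init (x∈p∧x≢y⇒x∈p-y u∈S u≢w)) uw
                             (λ y uy y≢w → init (x∈p∧x≢y⇒x∈p-y (neighbours∈S y uy) y≢w))
      ... | no y≢w = init (x∈p∧x≢y⇒x∈p-y y∈S y≢w)

connected⇒has-neighbour : ∀ {m} {H : Graph (suc (suc m))} → Connected H → ∀ v → ∃ (Adj H v)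
connected⇒has-neighbour {H = H} conn v = first-step (conn v (punchIn v zero)) (punchInᵢ≢i v zero ∘ sym)
  where
    first-step : ∀ {u w} → Star (Adj H) u w → u ≢ w → ∃ (Adj H u)
    first-step ε         u≢u = contradiction refl u≢u
    first-step (uy ◅ _) _    = _ , uy

module _ {n m : ℕ} where

  slice : Subset (n * m) → Fin n → Subset m
  slice R = lookup (proj₁ (group n m R))

  lookup-slice : ∀ (R : Subset (n * m)) c v → lookup (slice R c) v ≡ lookup R (combine c v)
  lookup-slice R c v = sym (trans (cong (λ X → lookup X (combine c v)) (proj₂ (group n m R)))
                                  (lookup-concat (proj₁ (group n m R)) c v))

  ∈-slice⁺ : ∀ {R} c v → combine c v ∈ R → v ∈ slice R c
  ∈-slice⁺ {R} c v cv∈R = lookup⇒[]= v (slice R c) (trans (lookup-slice R c v) ([]=⇒lookup cv∈R))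

  ∣R∣≡sum∣slices∣ : ∀ (R : Subset (n * m)) → ∣ R ∣ ≡ sum (map ∣_∣ (proj₁ (group n m R)))
  ∣R∣≡sum∣slices∣ R with group n m R
  ... | Rs , refl = ∣concat∣≡sum Rs

  ∣full-slice∣ : ∀ {R c} → (∀ v → combine c v ∈ R) → ∣ slice R c ∣ ≡ m
  ∣full-slice∣ {R} {c} full =
    ≤-antisym (∣p∣≤n (slice R c))
              (subst (_≤ ∣ slice R c ∣) (∣⊤∣≡n m) (p⊆q⇒∣p∣≤∣q∣ {p = ⊤} (λ {v} _ → ∈-slice⁺ c v (full v))))

  ∣R∣≡∣slice∣+full-copies : ∀ {R} a → (∀ c (v : Fin m) → c ≢ a → combine c v ∈ R) →
                            ∣ R ∣ ≡ ∣ slice R a ∣ + (n ∸ 1) * m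
  ∣R∣≡∣slice∣+full-copies {R} a full = begin
    ∣ R ∣                                         ≡⟨ ∣R∣≡sum∣slices∣ R ⟩
    sum (map ∣_∣ Rs)                              ≡⟨ sum-all-but-one (map ∣_∣ Rs) a ∣slice∣≡m ⟩
    lookup (map ∣_∣ Rs) a + (n ∸ 1) * m           ≡⟨ cong (_+ (n ∸ 1) * m) (lookup-map a ∣_∣ Rs) ⟩
    ∣ slice R a ∣ + (n ∸ 1) * m                   ∎
    where
      open ≡-Reasoning
      Rs = proj₁ (group n m R)
      ∣slice∣≡m : ∀ c → c ≢ a → lookup (map ∣_∣ Rs) c ≡ m
      ∣slice∣≡m c c≢a = trans (lookup-map c ∣_∣ Rs) (∣full-slice∣ (λ v → full c v c≢a))

lex-combine : ∀ {n m} (G : Graph n) (H : Graph m) c x d y →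
              lex G H (combine c x) (combine d y) ≡ G c d ∨ (⌊ c ≟ d ⌋ ∧ H x y)
lex-combine {n} {m} G H c x d y = cong₂ lexᵖ (remQuot-combine {n} {m} c x) (remQuot-combine d y)
  where
    lexᵖ : Fin n × Fin m → Fin n × Fin m → Bool
    lexᵖ (a , v) (b , w) = G a b ∨ (⌊ a ≟ b ⌋ ∧ H v w)

adjacent⇒distinct : ∀ {m} (H : Graph m) → (∀ u → H u u ≡ false) → ∀ {u v} → Adj H u v → u ≢ v
adjacent⇒distinct H loopless {u} uv refl with () ← trans (sym (loopless u)) uv

module _ {n m : ℕ} (H : Graph m) where

  adj-between-copies : ∀ {c d} x y → c ≢ d → Adj (lex (K n) H) (combine c x) (combine d y)
  adj-between-copies {c} {d} x y c≢d rewrite lex-combine (K n) H c x d y with c ≟ d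
  ... | yes c≡d = contradiction c≡d c≢d
  ... | no _    = refl

  lex-within-copy : ∀ c x y → lex (K n) H (combine c x) (combine c y) ≡ H x y
  lex-within-copy c x y rewrite lex-combine (K n) H c x c y with c ≟ c
  ... | yes _   = refl
  ... | no c≢c  = contradiction refl c≢c

  adj-within-copy⁺ : ∀ c {x y} → Adj H x y → Adj (lex (K n) H) (combine c x) (combine c y)
  adj-within-copy⁺ c {x} {y} = trans (lex-within-copy c x y)

  adj-within-copy⁻ : ∀ c x y → Adj (lex (K n) H) (combine c x) (combine c y) → Adj H x y
  adj-within-copy⁻ c x y = trans (sym (lex-within-copy c x y))

-- T ++ ⊤ is T on copy 0 and everything on the other copies, as combine zero v = v ↑ˡ _.
module _ {n m : ℕ} {H : Graph m} {T : Subset m} where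

  ∈-other-copy : ∀ (c : Fin n) (v : Fin m) → combine (suc c) v ∈ T ++ ⊤
  ∈-other-copy c v =
    lookup⇒[]= _ (T ++ ⊤) (trans (lookup-++ʳ T ⊤ (combine c v)) ([]=⇒lookup (∈⊤ {x = combine c v})))

  Black-first-copy : ∀ {v} → Black H T v → Black (lex (K (suc n)) H) (T ++ ⊤) (combine (zero {n}) v)
  Black-first-copy (init v∈T) = init (lookup⇒[]= _ (T ++ ⊤) (trans (lookup-++ˡ T ⊤ _) ([]=⇒lookup v∈T)))
  Black-first-copy (force {u} {v} bu uv rest) =
    force (Black-first-copy bu) (adj-within-copy⁺ H zero uv) others
    where
      others : ∀ w → Adj (lex (K (suc n)) H) (combine (zero {n}) u) w → w ≢ combine (zero {n}) v →
               Black (lex (K (suc n)) H) (T ++ ⊤) w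
      others w uw w≢v with combine-surjective {suc n} {m} w
      ... | zero  , y , refl =
        Black-first-copy (rest y (adj-within-copy⁻ H zero u y uw) (w≢v ∘ cong (combine (zero {n}))))
      ... | suc c , y , refl = init (∈-other-copy c y)

  lex-upper : IsZeroForcingSet H T → IsZeroForcingSet (lex (K (suc n)) H) (T ++ ⊤)
  lex-upper T-zfs i with combine-surjective {suc n} {m} i
  ... | zero  , v , refl = Black-first-copy (T-zfs v)
  ... | suc c , v , refl = init (∈-other-copy c v)

module _ {n m : ℕ} {H : Graph m} (simple : IsSimple H) (has-neighbour : ∀ v → ∃ (Adj H v)) where

  slice-zero-forcing : ∀ {R} {a : Fin n} → (∀ c (v : Fin m) → c ≢ a → combine c v ∈ R) →
                       IsZeroForcingSet (lex (K n) H) R → IsZeroForcingSet H (slice R a)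
  slice-zero-forcing {R} {a} full R-zfs v = to-slice (R-zfs (combine a v)) v refl
    where
      to-slice : ∀ {i} → Black (lex (K n) H) R i → ∀ v → combine a v ≡ i → Black H (slice R a) v
      to-slice (init i∈R) v refl = init (∈-slice⁺ a v i∈R)
      to-slice (force {u} bu uv rest) v refl
        with forced-in-copy ← (λ y (uy : Adj (lex (K n) H) u (combine a y)) (y≢v : y ≢ v) →
                                  to-slice (rest _ uy (y≢v ∘ combine-injectiveʳ a y a v)) y refl)
           | combine-surjective {n} {m} u
      ... | d , x , refl with d ≟ a
      ... | yes refl = force (to-slice bu x refl) (adj-within-copy⁻ H a x v uv)
                         (λ y xy y≢v → forced-in-copy y (adj-within-copy⁺ H a xy) y≢v)
      ... | no d≢a   = force (forced-in-copy w (adj-between-copies H x w d≢a) w≢v) wv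
                         (λ y _ y≢v → forced-in-copy y (adj-between-copies H x y d≢a) y≢v)
        where
          w : Fin m
          w = proj₁ (has-neighbour v)
          wv : Adj H w v
          wv = trans (proj₁ simple w v) (proj₂ (has-neighbour v))
          w≢v : w ≢ v
          w≢v = adjacent⇒distinct H (proj₂ simple) wv

  module _ {z : ℕ} (z-minimum : ∀ T → IsZeroForcingSet H T → z ≤ ∣ T ∣) where

    closed-neighbourhood-bound : ∀ {R u} → IsZeroForcingSet (lex (K n) H) R → u ∈ R →
                                 (∀ w → Adj (lex (K n) H) u w → w ∈ R) → suc z + (n ∸ 1) * m ≤ ∣ R ∣
    closed-neighbourhood-bound {R} {u} R-zfs u∈R N⊆R with combine-surjective {n} {m} u
    ... | d , x , refl = begin
      suc z + (n ∸ 1) * m           ≤⟨ +-monoˡ-≤ ((n ∸ 1) * m) 1+z≤∣T∣ ⟩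
      ∣ slice R d ∣ + (n ∸ 1) * m   ≡⟨ ∣R∣≡∣slice∣+full-copies d other-copies-full ⟨
      ∣ R ∣                         ∎
      where
        open ≤-Reasoning
        other-copies-full : ∀ c (v : Fin m) → c ≢ d → combine c v ∈ R
        other-copies-full c v c≢d = N⊆R _ (adj-between-copies H x v (c≢d ∘ sym))
        T : Subset m
        T = slice R d
        w : Fin m
        w = proj₁ (has-neighbour x)
        xw : Adj H x w
        xw = proj₂ (has-neighbour x)
        N[x]⊆T : ∀ y → Adj H x y → y ∈ T
        N[x]⊆T y xy = ∈-slice⁺ d y (N⊆R _ (adj-within-copy⁺ H d xy))
        T-w-zfs : IsZeroForcingSet H (T - w)
        T-w-zfs = forced-vertex-removable (slice-zero-forcing other-copies-full R-zfs) (∈-slice⁺ d x u∈R)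
                                          xw (adjacent⇒distinct H (proj₂ simple) xw) N[x]⊆T
        1+z≤∣T∣ : suc z ≤ ∣ T ∣
        1+z≤∣T∣ = ≤-trans (s≤s (z-minimum (T - w) T-w-zfs)) (x∈p⇒∣p-x∣<∣p∣ (N[x]⊆T w xw))

    -- The vertex is only needed as a centre when S is the whole vertex set.
    lex-lower : Fin (n * m) → ∀ S → IsZeroForcingSet (lex (K n) H) S → z + (n ∸ 1) * m ≤ ∣ S ∣
    lex-lower v₀ S S-zfs = ≤-pred (begin
      suc z + (n ∸ 1) * m   ≤⟨ closed-neighbourhood-bound (Black-mono S⊆R ∘ S-zfs) centre∈R neighbours∈R ⟩
      ∣ R ∣                 ≤⟨ ∣R∣≤1+∣S∣ ⟩
      suc ∣ S ∣             ∎)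
      where
        open ≤-Reasoning
        open ClosedNeighbourhoodExtension (extend-to-closed-neighbourhood S-zfs v₀)

mainTheorem19 : (m n : ℕ) → 2 ≤ m → 2 ≤ n → (H : Graph m) → IsSimple H → Connected H →
                (z : ℕ) → IsZ H z → IsZ (lex (K n) H) (z + (n ∸ 1) * m)
mainTheorem19 m@(suc (suc _)) (suc n) (s≤s (s≤s _)) _ H simple conn z ((T , T-zfs , ∣T∣≡z) , z-minimum) =
  (T ++ ⊤ , lex-upper T-zfs , ∣T++⊤∣) ,
  lex-lower simple (connected⇒has-neighbour conn) z-minimum (combine {suc n} {m} zero zero)
  where
    ∣T++⊤∣ : ∣ T ++ ⊤ ∣ ≡ z + n * m
    ∣T++⊤∣ = trans (∣p++q∣≡∣p∣+∣q∣ T ⊤) (cong₂ _+_ ∣T∣≡z (∣⊤∣≡n (n * m)))
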